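{- For $\mathbf{a}, \mathbf{b} \in \mathbb{N}[\overline{\mathbb{Z}}^*]$, $I_i(\mathbf{a}\mathbf{b}) = I_i(\mathbf{a}) + I_i(\mathbf{b})$.
   Context: Colored words are finite words over $\overline{\mathbb{Z}}=\{i^{[j]} : i\in\mathbb{Z}, j\in\mathbb{Z}_+\}$ (value $i$, color $j$), totally ordered by value then color. The product $\mathbf{a}\mathbf{b}$ is the colored shuffle product, defined on words by $\boldsymbol{p}\boldsymbol{q} = \boldsymbol{p} \sqcup\!\sqcup (\boldsymbol{q}\uparrow \operatorname{maxcol}(\boldsymbol{p}))$, where $\sqcup\!\sqcup$ is the Eilenberg–Mac Lane shuffle product (sum of all order-preserving interlacings), $\operatorname{maxcol}$ the maximal color and $\uparrow a$ adds $a$ to every color; extended bilinearly. Elements of $\mathbb{N}[\overline{\mathbb{Z}}^*]$ ($\mathbb{N}$-linear combinations of colored words) are treated as multisets. For a word $\boldsymbol{p}$, $I(\boldsymbol{p})$ is the length of its longest strictly increasing suffix, and $I_i(\boldsymbol{p})=I(\boldsymbol{p})$ if the value of the last entry of $\boldsymbol{p}$ is $\le i$, else $0$. For a multiset $X$ of words, $I_i(X)=\max_{\boldsymbol{p}\in X}I_i(\boldsymbol{p})$. -}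

module Defs where

open import Data.Nat using (ℕ; zero; suc; _+_; _⊔_; _≤_; _<_; s≤s; z≤n)
open import Data.Nat.Properties using (≤-trans; m≤m+n)
import Data.Nat as ℕ
import Data.Integer as ℤ
open import Data.Integer using (ℤ)
open import Data.List using (List; []; _∷_; _++_; map; concatMap; foldr; reverse)
open import Data.Bool using (Bool; true; false; if_then_else_)
open import Data.Sum using (_⊎_)
open import Data.Product using (_×_)
open import Relation.Binary.PropositionalEquality using (_≡_)
open import Relation.Nullary using (Dec; yes; no)
open import Relation.Nullary.Decidable using (⌊_⌋)

record Letter : Set where
  constructor _^[_∣_]
  field
    val    : ℤ
    col    : ℕ
    colPos : 1 ≤ col
open Letter public

_<L_ : Letter → Letter → Set
x <L y = (val x ℤ.< val y) ⊎ ((val x ≡ val y) × (col x < col y))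

_<L?_ : (x y : Letter) → Bool
x <L? y with val x ℤ.<? val y
... | yes _ = true
... | no _ with val x ℤ.≟ val y
...   | yes _ = ⌊ col x ℕ.<? col y ⌋
...   | no _ = false

Word : Set
Word = List Letter

-- Multisets of colored words = elements of ℕ[Z̄*] (a list, counted with multiplicity).
MSet : Set
MSet = List Word

maxcol : Word → ℕ
maxcol = foldr (λ l m → col l ⊔ m) 0

shiftLetter : ℕ → Letter → Letter
shiftLetter a (v ^[ c ∣ p ]) = v ^[ c + a ∣ ≤-trans p (m≤m+n c a) ]

_↑_ : Word → ℕ → Word
q ↑ a = map (shiftLetter a) q

shuffle : Word → Word → MSet
shuffle [] ys = ys ∷ []
shuffle (x ∷ xs) [] = (x ∷ xs) ∷ []
shuffle (x ∷ xs) (y ∷ ys) =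
  map (x ∷_) (shuffle xs (y ∷ ys)) ++ map (y ∷_) (shuffle (x ∷ xs) ys)

colShuffle : Word → Word → MSet
colShuffle p q = shuffle p (q ↑ maxcol p)

_·_ : MSet → MSet → MSet
a · b = concatMap (λ p → concatMap (λ q → colShuffle p q) b) a

-- length of the longest strictly decreasing prefix of a list
-- (applied to the reversed word this is the longest strictly increasing suffix)
decPrefix : Word → ℕ
decPrefix [] = 0
decPrefix (x ∷ []) = 1
decPrefix (x ∷ y ∷ rest) = if y <L? x then suc (decPrefix (y ∷ rest)) else 1

I : Word → ℕ
I p = decPrefix (reverse p)

-- I_i(p) = I(p) if the value of the last entry of p is ≤ i, else 0
-- (for the empty word I(p) = 0, so I_i = 0)
lastLe : ℤ → Word → Bool
lastLe i p with reverse p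
... | [] = true
... | x ∷ _ = ⌊ val x ℤ.≤? i ⌋

Iᵢ : ℤ → Word → ℕ
Iᵢ i p = if lastLe i p then I p else 0

IᵢM : ℤ → MSet → ℕ
IᵢM i X = foldr _⊔_ 0 (map (Iᵢ i) X)

{-# OPTIONS --safe #-}
-- Read backwards, I_i(p) is the length of the longest strictly decreasing prefix of reverse p
-- whose first letter lies below ceiling i = (i+1)^[1]; so everything reduces to the decreasing
-- run below a bound b, for an arbitrary decidable strict order. In an interleaving of P and Q
-- such a run splits into runs of P and of Q, which gives ≤. If every letter of P is comparable
-- with every letter of Q, emitting greedily the larger of the two heads merges the two runs into
-- a single run of an interleaving, which gives ≥. In the coloured product p (q ↑ maxcol p) the
-- letters of p and of the shifted q have different colours, hence are comparable, and the shift
-- is an order embedding, so I_i(q ↑ a) = I_i(q). Maximising over the two nonempty multisets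
-- gives the proposition.
module Submission where

open import Defs
open import Data.Integer using (ℤ)
import Data.Integer as ℤ
import Data.Integer.Properties as ℤ
open import Data.Nat using (ℕ; suc; _+_; _⊔_; _≤_; _<_; s≤s; z≤n)
import Data.Nat as ℕ
open import Data.Nat.Properties
open import Data.List using (List; []; _∷_; map; concatMap; foldr; reverse)
open import Data.List.Properties using (reverse-involutive; reverse-map)
open import Data.List.Membership.Propositional using (_∈_; find; lose)
open import Data.List.Membership.Propositional.Properties
  using (∈-map⁺; ∈-map⁻; ∈-++⁺ˡ; ∈-++⁺ʳ; ∈-++⁻; ∈-concatMap⁺; ∈-concatMap⁻)
open import Data.List.Relation.Unary.Any using (here; there)
import Data.List.Relation.Unary.Any.Properties as Any
open import Data.List.Relation.Binary.Pointwise using (≡⇒Pointwise-≡)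
open import Data.List.Relation.Ternary.Interleaving using ([]; _∷ˡ_; _∷ʳ_; left; right; swap)
open import Data.List.Relation.Ternary.Interleaving.Propositional using (Interleaving)
import Data.List.Relation.Ternary.Interleaving.Properties as Interleaving
open import Data.Sum using (_⊎_; inj₁; inj₂)
open import Data.Product using (_×_; _,_; ∃-syntax)
open import Function using (_∘_)
open import Function.Bundles using (_⇔_; mk⇔; Equivalence)
open import Relation.Binary using (Rel; Decidable; Transitive; tri<; tri≈; tri>)
open import Relation.Binary.PropositionalEquality
  using (_≡_; _≢_; refl; sym; trans; cong; cong₂; subst; module ≡-Reasoning)
open import Relation.Nullary using (Dec; yes; no; does; ¬_; contradiction)

open Equivalence using (to; from)

module DecreasingPrefix {a ℓ} {A : Set a} {_<_ : Rel A ℓ}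
                        (_<?_ : Decidable _<_) (<-trans : Transitive _<_) where

  decPrefixBelow : A → List A → ℕ
  decPrefixBelow b [] = 0
  decPrefixBelow b (x ∷ W) with x <? b
  ... | yes _ = suc (decPrefixBelow x W)
  ... | no _ = 0

  decPrefixBelow-< : ∀ {x b W} → x < b → decPrefixBelow b (x ∷ W) ≡ suc (decPrefixBelow x W)
  decPrefixBelow-< {x} {b} x<b with x <? b
  ... | yes _ = refl
  ... | no x≮b = contradiction x<b x≮b

  decPrefixBelow-≮ : ∀ {x b W} → ¬ x < b → decPrefixBelow b (x ∷ W) ≡ 0
  decPrefixBelow-≮ {x} {b} x≮b with x <? b
  ... | yes x<b = contradiction x<b x≮b
  ... | no _ = refl

  decPrefixBelow-mono : ∀ {x b} → x < b → ∀ W → decPrefixBelow x W ≤ decPrefixBelow b W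
  decPrefixBelow-mono x<b [] = z≤n
  decPrefixBelow-mono {x} x<b (y ∷ W) with y <? x
  ... | yes y<x = ≤-reflexive (sym (decPrefixBelow-< (<-trans y<x x<b)))
  ... | no _ = z≤n

  decPrefixBelow-∷-≤ : ∀ {x y b Q} → y < x ⊎ ¬ y < b →
                       decPrefixBelow b (y ∷ Q) ≤ decPrefixBelow x (y ∷ Q)
  decPrefixBelow-∷-≤ {x} {y} {b} h with y <? b | y <? x
  ... | no _ | _ = z≤n
  ... | yes _ | yes _ = ≤-refl
  ... | yes y<b | no y≮x with h
  ...   | inj₁ y<x = contradiction y<x y≮x
  ...   | inj₂ y≮b = contradiction y<b y≮b

  decPrefixBelow-map : ∀ {f : A → A} {b c} →
                       (∀ x y → f x < f y ⇔ x < y) → (∀ x → f x < c ⇔ x < b) →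
                       ∀ W → decPrefixBelow c (map f W) ≡ decPrefixBelow b W
  decPrefixBelow-map embed bound [] = refl
  decPrefixBelow-map {b = b} embed bound (x ∷ W) with x <? b
  ... | yes x<b = trans (decPrefixBelow-< (from (bound x) x<b))
                       (cong suc (decPrefixBelow-map embed (λ y → embed y x) W))
  ... | no x≮b = decPrefixBelow-≮ (x≮b ∘ to (bound x))

  decPrefixBelow-interleaving : ∀ {P Q W} → Interleaving P Q W → ∀ b →
    decPrefixBelow b W ≤ decPrefixBelow b P + decPrefixBelow b Q
  decPrefixBelow-interleaving [] b = z≤n
  decPrefixBelow-interleaving {x ∷ P} {Q} (refl ∷ˡ s) b with x <? b
  ... | yes x<b = s≤s (≤-trans (decPrefixBelow-interleaving s x)
                                (+-monoʳ-≤ _ (decPrefixBelow-mono x<b Q)))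
  ... | no _ = z≤n
  decPrefixBelow-interleaving {P} {y ∷ Q} (refl ∷ʳ s) b with y <? b
  ... | yes y<b = ≤-trans (s≤s (≤-trans (decPrefixBelow-interleaving s y)
                                         (+-monoˡ-≤ _ (decPrefixBelow-mono y<b P))))
                          (≤-reflexive (sym (+-suc _ _)))
  ... | no _ = z≤n

  AdditiveMerge : A → List A → List A → Set a
  AdditiveMerge b P Q = ∃[ W ] Interleaving P Q W ×
    decPrefixBelow b P + decPrefixBelow b Q ≤ decPrefixBelow b W

  AdditiveMerge-swap : ∀ {b P Q} → AdditiveMerge b P Q → AdditiveMerge b Q P
  AdditiveMerge-swap {b} {P} {Q} (W , s , h) =
    W , swap s , ≤-trans (≤-reflexive (+-comm (decPrefixBelow b Q) (decPrefixBelow b P))) h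

  AdditiveMerge-∷ˡ : ∀ {x b P Q} → x < b → decPrefixBelow b Q ≤ decPrefixBelow x Q →
                     AdditiveMerge x P Q → AdditiveMerge b (x ∷ P) Q
  AdditiveMerge-∷ˡ {x} {b} {P} {Q} x<b bQ≤xQ (W , s , h) = x ∷ W , refl ∷ˡ s , (begin
    decPrefixBelow b (x ∷ P) + decPrefixBelow b Q ≡⟨ cong (_+ _) (decPrefixBelow-< x<b) ⟩
    suc (decPrefixBelow x P + decPrefixBelow b Q) ≤⟨ s≤s (+-monoʳ-≤ _ bQ≤xQ) ⟩
    suc (decPrefixBelow x P + decPrefixBelow x Q) ≤⟨ s≤s h ⟩
    suc (decPrefixBelow x W)                      ≡⟨ decPrefixBelow-< x<b ⟨
    decPrefixBelow b (x ∷ W)                      ∎)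
    where open ≤-Reasoning

  AdditiveMerge-∷ʳ : ∀ {y b P Q} → y < b → decPrefixBelow b P ≤ decPrefixBelow y P →
                     AdditiveMerge y P Q → AdditiveMerge b P (y ∷ Q)
  AdditiveMerge-∷ʳ y<b bP≤yP = AdditiveMerge-swap ∘ AdditiveMerge-∷ˡ y<b bP≤yP ∘ AdditiveMerge-swap

  additiveMerge : ∀ P Q → (∀ {x y} → x ∈ P → y ∈ Q → x < y ⊎ y < x) →
                  ∀ b → AdditiveMerge b P Q
  additiveMerge [] Q _ b = Q , right (≡⇒Pointwise-≡ refl) , ≤-refl
  additiveMerge P [] _ b = P , left (≡⇒Pointwise-≡ refl) , ≤-reflexive (+-identityʳ _)
  additiveMerge (x ∷ P) (y ∷ Q) comparable b =
    choose (x <? b) (y <? b) (comparable (here refl) (here refl))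
      (additiveMerge P (y ∷ Q) (comparable ∘ there) x)
      (additiveMerge (x ∷ P) Q (λ x∈ → comparable x∈ ∘ there) y)
    where
    choose : Dec (x < b) → Dec (y < b) → x < y ⊎ y < x →
             AdditiveMerge x P (y ∷ Q) → AdditiveMerge y (x ∷ P) Q →
             AdditiveMerge b (x ∷ P) (y ∷ Q)
    choose (yes x<b) (yes _)   (inj₂ y<x) mergeˡ _ = AdditiveMerge-∷ˡ x<b (decPrefixBelow-∷-≤ (inj₁ y<x)) mergeˡ
    choose (yes x<b) (no y≮b)  _          mergeˡ _ = AdditiveMerge-∷ˡ x<b (decPrefixBelow-∷-≤ (inj₂ y≮b)) mergeˡ
    choose (yes _)   (yes y<b) (inj₁ x<y) _ mergeʳ = AdditiveMerge-∷ʳ y<b (decPrefixBelow-∷-≤ (inj₁ x<y)) mergeʳ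
    choose (no x≮b)  (yes y<b) _          _ mergeʳ = AdditiveMerge-∷ʳ y<b (decPrefixBelow-∷-≤ (inj₂ x≮b)) mergeʳ
    choose (no x≮b)  (no y≮b)  _ (W , s , _) _ = x ∷ W , refl ∷ˡ s ,
      ≤-trans (≤-reflexive (cong₂ _+_ (decPrefixBelow-≮ x≮b) (decPrefixBelow-≮ y≮b))) z≤n

_<L-dec_ : Decidable _<L_
x <L-dec y with val x ℤ.<? val y
... | yes v<v′ = yes (inj₁ v<v′)
... | no v≮v′ with val x ℤ.≟ val y
...   | no v≢v′ = no λ { (inj₁ v<v′) → v≮v′ v<v′ ; (inj₂ (v≡v′ , _)) → v≢v′ v≡v′ }
...   | yes v≡v′ with col x ℕ.<? col y
...     | yes c<c′ = yes (inj₂ (v≡v′ , c<c′))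
...     | no c≮c′ = no λ { (inj₁ v<v′) → v≮v′ v<v′ ; (inj₂ (_ , c<c′)) → c≮c′ c<c′ }

does-<L-dec : ∀ x y → does (x <L-dec y) ≡ (x <L? y)
does-<L-dec x y with val x ℤ.<? val y
... | yes _ = refl
... | no _ with val x ℤ.≟ val y
...   | no _ = refl
...   | yes _ with col x ℕ.<? col y
...     | yes _ = refl
...     | no _ = refl

<L-trans : Transitive _<L_
<L-trans (inj₁ v<v′) (inj₁ v′<v″) = inj₁ (ℤ.<-trans v<v′ v′<v″)
<L-trans (inj₁ v<v′) (inj₂ (refl , _)) = inj₁ v<v′
<L-trans (inj₂ (refl , _)) (inj₁ v′<v″) = inj₁ v′<v″
<L-trans (inj₂ (refl , c<c′)) (inj₂ (refl , c′<c″)) = inj₂ (refl , <-trans c<c′ c′<c″)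

<L-connex-col : ∀ {x y} → col x < col y → x <L y ⊎ y <L x
<L-connex-col {x} {y} c<c′ with ℤ.<-cmp (val x) (val y)
... | tri< v<v′ _ _ = inj₁ (inj₁ v<v′)
... | tri≈ _ v≡v′ _ = inj₁ (inj₂ (v≡v′ , c<c′))
... | tri> _ _ v>v′ = inj₂ (inj₁ v>v′)

-- _<L_ unfolds to a sum, so the implicit letters of <L-trans cannot be inferred from its uses.
open DecreasingPrefix {_<_ = _<L_} _<L-dec_ (λ {x} {y} {z} → <L-trans {x} {y} {z})

decPrefix-∷ : ∀ x W → decPrefix (x ∷ W) ≡ suc (decPrefixBelow x W)
decPrefix-∷ x [] = refl
decPrefix-∷ x (y ∷ W) rewrite sym (does-<L-dec y x) with y <L-dec x
... | yes _ = cong suc (decPrefix-∷ y W)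
... | no _ = refl

-- Colours are positive, so the letters below ceiling i are exactly those of value ≤ i.
ceiling : ℤ → Letter
ceiling i = ℤ.suc i ^[ 1 ∣ ≤-refl ]

<L-ceiling⇔ : ∀ x i → x <L ceiling i ⇔ val x ℤ.≤ i
<L-ceiling⇔ x i = mk⇔ below⇒≤ ≤⇒below
  where
  below⇒≤ : x <L ceiling i → val x ℤ.≤ i
  below⇒≤ (inj₁ x<i+1) = subst (val x ℤ.≤_) (ℤ.pred-suc i) (ℤ.i<j⇒i≤pred[j] x<i+1)
  below⇒≤ (inj₂ (_ , col<1)) = contradiction (colPos x) (<⇒≱ col<1)
  ≤⇒below : val x ℤ.≤ i → x <L ceiling i
  ≤⇒below x≤i = inj₁ (ℤ.i≤pred[j]⇒i<j (subst (val x ℤ.≤_) (sym (ℤ.pred-suc i)) x≤i))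

Iᵢ-reverse : ∀ i p → Iᵢ i p ≡ decPrefixBelow (ceiling i) (reverse p)
Iᵢ-reverse i p with reverse p
... | [] = refl
... | x ∷ W with val x ℤ.≤? i
...   | yes x≤i = trans (decPrefix-∷ x W) (sym (decPrefixBelow-< (from (<L-ceiling⇔ x i) x≤i)))
...   | no x≰i = sym (decPrefixBelow-≮ (x≰i ∘ to (<L-ceiling⇔ x i)))

shiftLetter-<L⇔ : ∀ a x y → shiftLetter a x <L shiftLetter a y ⇔ x <L y
shiftLetter-<L⇔ a x y = mk⇔
  (λ { (inj₁ v<v′) → inj₁ v<v′ ; (inj₂ (v≡v′ , c<c′)) → inj₂ (v≡v′ , +-cancelʳ-< a (col x) (col y) c<c′) })
  (λ { (inj₁ v<v′) → inj₁ v<v′ ; (inj₂ (v≡v′ , c<c′)) → inj₂ (v≡v′ , +-monoˡ-< a c<c′) })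

Iᵢ-↑ : ∀ i q a → Iᵢ i (q ↑ a) ≡ Iᵢ i q
Iᵢ-↑ i q a = begin
  Iᵢ i (q ↑ a)                         ≡⟨ Iᵢ-reverse i (q ↑ a) ⟩
  decPrefixBelow c (reverse (map sh q)) ≡⟨ cong (decPrefixBelow c) (reverse-map sh q) ⟨
  decPrefixBelow c (map sh (reverse q)) ≡⟨ decPrefixBelow-map (shiftLetter-<L⇔ a) sh-<L-ceiling⇔ (reverse q) ⟩
  decPrefixBelow c (reverse q)          ≡⟨ Iᵢ-reverse i q ⟨
  Iᵢ i q                                ∎
  where
  open ≡-Reasoning
  c = ceiling i
  sh = shiftLetter a
  sh-<L-ceiling⇔ : ∀ x → sh x <L c ⇔ x <L c
  sh-<L-ceiling⇔ x = mk⇔ (from (<L-ceiling⇔ x i) ∘ to (<L-ceiling⇔ (sh x) i))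
                         (from (<L-ceiling⇔ (sh x) i) ∘ to (<L-ceiling⇔ x i))

interleaving-[]ˡ : ∀ {A : Set} {q w : List A} → Interleaving [] q w → w ≡ q
interleaving-[]ˡ [] = refl
interleaving-[]ˡ (refl ∷ʳ s) = cong (_ ∷_) (interleaving-[]ˡ s)

∈-shuffle⁻ : ∀ p q {w} → w ∈ shuffle p q → Interleaving p q w
∈-shuffle⁻ [] _ (here refl) = right (≡⇒Pointwise-≡ refl)
∈-shuffle⁻ (_ ∷ _) [] (here refl) = left (≡⇒Pointwise-≡ refl)
∈-shuffle⁻ (x ∷ p) (y ∷ q) w∈ with ∈-++⁻ (map (x ∷_) (shuffle p (y ∷ q))) w∈
... | inj₁ w∈ˡ with ∈-map⁻ (x ∷_) w∈ˡ
...   | _ , w′∈ , refl = refl ∷ˡ ∈-shuffle⁻ p (y ∷ q) w′∈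
∈-shuffle⁻ (x ∷ p) (y ∷ q) w∈ | inj₂ w∈ʳ with ∈-map⁻ (y ∷_) w∈ʳ
...   | _ , w′∈ , refl = refl ∷ʳ ∈-shuffle⁻ (x ∷ p) q w′∈

∈-shuffle⁺ : ∀ {p q w} → Interleaving p q w → w ∈ shuffle p q
∈-shuffle⁺ [] = here refl
∈-shuffle⁺ {x ∷ p} {[]} s = here (interleaving-[]ˡ (swap s))
∈-shuffle⁺ {x ∷ p} {y ∷ q} (refl ∷ˡ s) = ∈-++⁺ˡ (∈-map⁺ (x ∷_) (∈-shuffle⁺ s))
∈-shuffle⁺ {[]} s = here (interleaving-[]ˡ s)
∈-shuffle⁺ {x ∷ p} {y ∷ q} (refl ∷ʳ s) =
  ∈-++⁺ʳ (map (x ∷_) (shuffle p (y ∷ q))) (∈-map⁺ (y ∷_) (∈-shuffle⁺ s))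

Iᵢ-interleaving-≤ : ∀ i {p q w} → Interleaving p q w → Iᵢ i w ≤ Iᵢ i p + Iᵢ i q
Iᵢ-interleaving-≤ i {p} {q} {w} s = begin
  Iᵢ i w                                                      ≡⟨ Iᵢ-reverse i w ⟩
  decPrefixBelow c (reverse w)                                ≤⟨ decPrefixBelow-interleaving (Interleaving.reverse⁺ s) c ⟩
  decPrefixBelow c (reverse p) + decPrefixBelow c (reverse q) ≡⟨ cong₂ _+_ (Iᵢ-reverse i p) (Iᵢ-reverse i q) ⟨
  Iᵢ i p + Iᵢ i q                                             ∎
  where
  open ≤-Reasoning
  c = ceiling i

Iᵢ-interleaving-attained : ∀ i p q → (∀ {x y} → x ∈ p → y ∈ q → col x < col y) →
                           ∃[ w ] Interleaving p q w × Iᵢ i p + Iᵢ i q ≤ Iᵢ i w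
Iᵢ-interleaving-attained i p q col<col =
  let W , s , sum≤ = additiveMerge (reverse p) (reverse q) comparable c in
  reverse W ,
  Interleaving.reverse⁻ (subst (Interleaving (reverse p) (reverse q)) (sym (reverse-involutive W)) s) ,
  (begin
    Iᵢ i p + Iᵢ i q                                             ≡⟨ cong₂ _+_ (Iᵢ-reverse i p) (Iᵢ-reverse i q) ⟩
    decPrefixBelow c (reverse p) + decPrefixBelow c (reverse q) ≤⟨ sum≤ ⟩
    decPrefixBelow c W                                          ≡⟨ cong (decPrefixBelow c) (reverse-involutive W) ⟨
    decPrefixBelow c (reverse (reverse W))                      ≡⟨ Iᵢ-reverse i (reverse W) ⟨
    Iᵢ i (reverse W)                                            ∎)
  where
  open ≤-Reasoning
  c = ceiling i
  comparable : ∀ {x y} → x ∈ reverse p → y ∈ reverse q → x <L y ⊎ y <L x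
  comparable {x} {y} x∈ y∈ = <L-connex-col {x} {y} (col<col (Any.reverse⁻ x∈) (Any.reverse⁻ y∈))

col≤maxcol : ∀ {x p} → x ∈ p → col x ≤ maxcol p
col≤maxcol {p = y ∷ p} (here refl) = m≤m⊔n (col y) (maxcol p)
col≤maxcol {p = y ∷ p} (there x∈) = ≤-trans (col≤maxcol x∈) (m≤n⊔m (col y) (maxcol p))

col-↑ : ∀ {y} q a → y ∈ q ↑ a → a < col y
col-↑ q a y∈ with ∈-map⁻ (shiftLetter a) y∈
... | x , _ , refl = +-monoˡ-≤ a (colPos x)

Iᵢ-colShuffle-≤ : ∀ i p q {w} → w ∈ colShuffle p q → Iᵢ i w ≤ Iᵢ i p + Iᵢ i q
Iᵢ-colShuffle-≤ i p q {w} w∈ = subst (Iᵢ i w ≤_) (cong (Iᵢ i p +_) (Iᵢ-↑ i q (maxcol p)))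
                                  (Iᵢ-interleaving-≤ i (∈-shuffle⁻ p (q ↑ maxcol p) w∈))

Iᵢ-colShuffle-attained : ∀ i p q → ∃[ w ] w ∈ colShuffle p q × Iᵢ i p + Iᵢ i q ≤ Iᵢ i w
Iᵢ-colShuffle-attained i p q =
  let w , s , sum≤ = Iᵢ-interleaving-attained i p (q ↑ maxcol p)
                       (λ x∈ y∈ → ≤-<-trans (col≤maxcol x∈) (col-↑ q (maxcol p) y∈))
  in w , ∈-shuffle⁺ s , subst (_≤ Iᵢ i w) (cong (Iᵢ i p +_) (Iᵢ-↑ i q (maxcol p))) sum≤

maxOf : ∀ {A : Set} → (A → ℕ) → List A → ℕ
maxOf f X = foldr _⊔_ 0 (map f X)

module _ {A : Set} (f : A → ℕ) where

  ≤-maxOf : ∀ {x X} → x ∈ X → f x ≤ maxOf f X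
  ≤-maxOf {X = y ∷ X} (here refl) = m≤m⊔n (f y) (maxOf f X)
  ≤-maxOf {X = y ∷ X} (there x∈) = ≤-trans (≤-maxOf x∈) (m≤n⊔m (f y) (maxOf f X))

  maxOf-lub : ∀ {n} X → (∀ {x} → x ∈ X → f x ≤ n) → maxOf f X ≤ n
  maxOf-lub [] _ = z≤n
  maxOf-lub (x ∷ X) bound = ⊔-lub (bound (here refl)) (maxOf-lub X (bound ∘ there))

  maxOf-attained : ∀ X → X ≢ [] → ∃[ x ] x ∈ X × maxOf f X ≡ f x
  maxOf-attained [] X≢[] = contradiction refl X≢[]
  maxOf-attained (x ∷ []) _ = x , here refl , ⊔-identityʳ (f x)
  maxOf-attained (x ∷ y ∷ X) _
    with ⊔-sel (f x) (maxOf f (y ∷ X)) | maxOf-attained (y ∷ X) (λ ())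
  ... | inj₁ max≡fx | _ = x , here refl , max≡fx
  ... | inj₂ max≡rest | z , z∈ , rest≡fz = z , there z∈ , trans max≡rest rest≡fz

∈-·⁻ : ∀ a b {w} → w ∈ a · b → ∃[ p ] ∃[ q ] p ∈ a × q ∈ b × w ∈ colShuffle p q
∈-·⁻ a b w∈ =
  let p , p∈ , w∈′ = find (∈-concatMap⁻ (λ p → concatMap (colShuffle p) b) {xs = a} w∈)
      q , q∈ , w∈″ = find (∈-concatMap⁻ (colShuffle p) {xs = b} w∈′)
  in p , q , p∈ , q∈ , w∈″

∈-·⁺ : ∀ a b {p q w} → p ∈ a → q ∈ b → w ∈ colShuffle p q → w ∈ a · b
∈-·⁺ a b {p} p∈ q∈ w∈ =
  ∈-concatMap⁺ (λ p → concatMap (colShuffle p) b) {xs = a}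
    (lose p∈ (∈-concatMap⁺ (colShuffle p) {xs = b} (lose q∈ w∈)))

proposition5p9 : (i : ℤ) (a b : MSet) → a ≢ [] → b ≢ [] →
    IᵢM i (a · b) ≡ IᵢM i a + IᵢM i b
proposition5p9 i a b a≢[] b≢[] = ≤-antisym upper lower
  where
  open ≤-Reasoning
  upper : IᵢM i (a · b) ≤ IᵢM i a + IᵢM i b
  upper = maxOf-lub (Iᵢ i) (a · b) λ w∈ →
    let p , q , p∈ , q∈ , w∈′ = ∈-·⁻ a b w∈ in
    ≤-trans (Iᵢ-colShuffle-≤ i p q w∈′) (+-mono-≤ (≤-maxOf (Iᵢ i) p∈) (≤-maxOf (Iᵢ i) q∈))
  lower : IᵢM i a + IᵢM i b ≤ IᵢM i (a · b)
  lower =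
    let p , p∈ , maxa≡ = maxOf-attained (Iᵢ i) a a≢[]
        q , q∈ , maxb≡ = maxOf-attained (Iᵢ i) b b≢[]
        w , w∈ , sum≤ = Iᵢ-colShuffle-attained i p q
    in begin
      IᵢM i a + IᵢM i b ≡⟨ cong₂ _+_ maxa≡ maxb≡ ⟩
      Iᵢ i p + Iᵢ i q   ≤⟨ sum≤ ⟩
      Iᵢ i w            ≤⟨ ≤-maxOf (Iᵢ i) (∈-·⁺ a b p∈ q∈ w∈) ⟩
      IᵢM i (a · b)     ∎
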